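{- The operator $\Diamond$ cannot be defined in terms of $\Box$ over the class of finite expanding models: there is no formula $\varphi\in\mathcal L_{\Box}$ such that $\Diamond p\leftrightarrow\varphi$ is valid over the class of all finite models based on dynamic posets (with $p$ a propositional variable).
   Context: Formulas of $\mathcal L$ are generated by $\varphi::=p\mid\bot\mid\varphi\wedge\varphi\mid\varphi\vee\varphi\mid\varphi\to\varphi\mid\bigcirc\varphi\mid\Diamond\varphi\mid\Box\varphi\mid\varphi\,\mathcal U\,\varphi\mid\varphi\,\mathcal R\,\varphi$ over a countable set of propositional variables; $\varphi\leftrightarrow\psi:=(\varphi\to\psi)\wedge(\psi\to\varphi)$. $\mathcal L_{\Box}$ is the fragment built from variables, $\bot,\wedge,\vee,\to,\bigcirc,\Box$ only. A dynamic poset is $(W,\preccurlyeq,S)$ with $W\ne\emptyset$, $\preccurlyeq$ a partial order, $S:W\to W$ with $w\preccurlyeq v\Rightarrow S(w)\preccurlyeq S(v)$. An (expanding) model is $(W,\preccurlyeq,S,V)$ with $(W,\preccurlyeq,S)$ a dynamic poset and $V$ assigning to each world a set of variables, with $w\preccurlyeq v\Rightarrow V(w)\subseteq V(v)$; it is finite if $W$ is finite. Satisfaction: $w\models p$ iff $p\in V(w)$; $w\not\models\bot$; $\wedge,\vee$ classical; $w\models\varphi\to\psi$ iff for all $v\succcurlyeq w$, $v\models\varphi$ implies $v\models\psi$; $w\models\bigcirc\varphi$ iff $S(w)\models\varphi$; $w\models\Diamond\varphi$ iff $\exists k\ge0$, $S^k(w)\models\varphi$; $w\models\Box\varphi$ iff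 $\forall k\ge0$, $S^k(w)\models\varphi$. Valid over a class means true at every world of every model in the class. -}

module Defs where

open import Data.Nat using (ℕ; zero; suc; _<_)
open import Data.Fin using (Fin)
open import Data.Bool using (Bool; true)
open import Data.Product using (_×_; Σ; ∃; _,_)
open import Data.Sum using (_⊎_)
open import Data.Empty using (⊥)
open import Data.Unit using (⊤)
open import Relation.Binary.PropositionalEquality using (_≡_)
open import Relation.Binary.Structures using (IsPartialOrder)

data Form : Set where
  var  : ℕ → Form
  ⊥'   : Form
  _∧'_ : Form → Form → Form
  _∨'_ : Form → Form → Form
  _⇒_  : Form → Form → Form
  ○    : Form → Form
  ◇    : Form → Form
  □    : Form → Form
  _𝒰_  : Form → Form → Form
  _ℛ_  : Form → Form → Form

_⇔_ : Form → Form → Form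
φ ⇔ ψ = (φ ⇒ ψ) ∧' (ψ ⇒ φ)

InLBox : Form → Set
InLBox (var _)   = ⊤
InLBox ⊥'        = ⊤
InLBox (φ ∧' ψ)  = InLBox φ × InLBox ψ
InLBox (φ ∨' ψ)  = InLBox φ × InLBox ψ
InLBox (φ ⇒ ψ)   = InLBox φ × InLBox ψ
InLBox (○ φ)     = InLBox φ
InLBox (◇ _)     = ⊥
InLBox (□ φ)     = InLBox φ
InLBox (_ 𝒰 _)   = ⊥
InLBox (_ ℛ _)   = ⊥

-- Finite (expanding) models: the world set is Fin n with n ≥ 1 (nonempty).
record FinModel : Set₁ where
  field
    n      : ℕ
    _≼_    : Fin (suc n) → Fin (suc n) → Set
    isPO   : IsPartialOrder _≡_ _≼_
    S      : Fin (suc n) → Fin (suc n)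
    S-mono : ∀ {w v} → w ≼ v → S w ≼ S v
    V      : Fin (suc n) → ℕ → Bool
    V-mono : ∀ {w v} p → w ≼ v → V w p ≡ true → V v p ≡ true

module _ (M : FinModel) where
  open FinModel M

  W : Set
  W = Fin (suc n)

  iter : ℕ → W → W
  iter zero    w = w
  iter (suc k) w = S (iter k w)

  -- The semantics of U and R is not fixed in the context; it is irrelevant
  -- here since neither occurs in ◇ p ↔ φ for φ ∈ L_□.  We use the standard
  -- (intuitionistic LTL) clauses.
  _⊨_ : W → Form → Set
  w ⊨ var p    = V w p ≡ true
  w ⊨ ⊥'       = ⊥
  w ⊨ (φ ∧' ψ) = (w ⊨ φ) × (w ⊨ ψ)
  w ⊨ (φ ∨' ψ) = (w ⊨ φ) ⊎ (w ⊨ ψ)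
  w ⊨ (φ ⇒ ψ)  = ∀ v → w ≼ v → v ⊨ φ → v ⊨ ψ
  w ⊨ ○ φ      = S w ⊨ φ
  w ⊨ ◇ φ      = ∃ λ k → iter k w ⊨ φ
  w ⊨ □ φ      = ∀ k → iter k w ⊨ φ
  w ⊨ (φ 𝒰 ψ)  = ∃ λ k → (iter k w ⊨ ψ) × (∀ i → i < k → iter i w ⊨ φ)
  w ⊨ (φ ℛ ψ)  = ∀ k → iter k w ⊨ ψ ⊎ (∃ λ i → i < k × iter i w ⊨ φ)

ValidFin : Form → Set₁
ValidFin φ = ∀ (M : FinModel) (w : Fin (suc (FinModel.n M))) → _⊨_ M w φ

module Submission where

-- Fix φ ∈ L_□ and let d be its ○-depth, the number of S-steps φ can look
-- ahead.  The counter-model is the chain 0 ≤ 1 ≤ … ≤ n with n = d + 2, where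
-- the bottom world 0 is a fixed point of S, every other world moves one step
-- up (stopping at the top n), and p holds exactly at the top.  Then ◇p holds
-- at 1 but fails at 0.

open import Defs
open import Data.Nat using (ℕ)
open import Data.Product using (Σ; _×_)
open import Relation.Nullary using (¬_)

open import Data.Nat as ℕ using (zero; suc; z≤n; s≤s; _+_; _⊓_; _⊔_)
open import Data.Nat.Properties as ℕP using ()
open import Data.Fin as F using (Fin; toℕ; fromℕ)
open import Data.Fin.Properties as FP using ()
open import Data.Bool using (Bool; true)
open import Data.Product using (_,_; proj₁; proj₂)
open import Data.Sum using (inj₁; inj₂)
open import Data.Empty using (⊥-elim)
open import Relation.Nullary using (does; yes; no)
open import Relation.Nullary.Decidable using (dec-true)
open import Relation.Binary.PropositionalEquality
open import Relation.Binary.Structures using (IsPartialOrder)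

module _ (M : FinModel) where
  open FinModel M
  open IsPartialOrder isPO using () renaming (refl to ≼-refl; trans to ≼-trans)

  iter-mono : ∀ k {w v} → w ≼ v → iter M k w ≼ iter M k v
  iter-mono zero    w≼v = w≼v
  iter-mono (suc k) w≼v = S-mono (iter-mono k w≼v)

  persist : ∀ φ {w v} → w ≼ v → _⊨_ M w φ → _⊨_ M v φ
  persist (var q)  w≼v h        = V-mono q w≼v h
  persist ⊥'       w≼v ()
  persist (φ ∧' ψ) w≼v (a , b)  = persist φ w≼v a , persist ψ w≼v b
  persist (φ ∨' ψ) w≼v (inj₁ a) = inj₁ (persist φ w≼v a)
  persist (φ ∨' ψ) w≼v (inj₂ b) = inj₂ (persist ψ w≼v b)
  persist (φ ⇒ ψ)  w≼v h        = λ u v≼u → h u (≼-trans w≼v v≼u)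
  persist (○ φ)    w≼v h        = persist φ (S-mono w≼v) h
  persist (◇ φ)    w≼v (k , h)  = k , persist φ (iter-mono k w≼v) h
  persist (□ φ)    w≼v h        = λ k → persist φ (iter-mono k w≼v) (h k)
  persist (φ 𝒰 ψ)  w≼v (k , a , b) =
    k , persist ψ (iter-mono k w≼v) a , λ i i<k → persist φ (iter-mono i w≼v) (b i i<k)
  persist (φ ℛ ψ)  w≼v h k with h k
  ... | inj₁ a           = inj₁ (persist ψ (iter-mono k w≼v) a)
  ... | inj₂ (i , i<k , b) = inj₂ (i , i<k , persist φ (iter-mono i w≼v) b)

  valid-⇔⇒ : ∀ φ ψ → (∀ w → _⊨_ M w (φ ⇔ ψ)) → ∀ w → _⊨_ M w φ → _⊨_ M w ψ
  valid-⇔⇒ _ _ valid w = proj₁ (valid w) w ≼-refl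

  valid-⇔⇐ : ∀ φ ψ → (∀ w → _⊨_ M w (φ ⇔ ψ)) → ∀ w → _⊨_ M w ψ → _⊨_ M w φ
  valid-⇔⇐ _ _ valid w = proj₂ (valid w) w ≼-refl

-- How many S-steps ahead a formula of L_□ can look.  (◇, 𝒰 and ℛ do not
-- occur in L_□; their value is irrelevant.)
○-depth : Form → ℕ
○-depth (var _)  = 0
○-depth ⊥'       = 0
○-depth (φ ∧' ψ) = ○-depth φ ⊔ ○-depth ψ
○-depth (φ ∨' ψ) = ○-depth φ ⊔ ○-depth ψ
○-depth (φ ⇒ ψ)  = ○-depth φ ⊔ ○-depth ψ
○-depth (○ φ)    = suc (○-depth φ)
○-depth (◇ _)    = 0
○-depth (□ φ)    = ○-depth φ
○-depth (_ 𝒰 _)  = 0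
○-depth (_ ℛ _)  = 0

succ-sat : ∀ {n} → Fin (suc n) → Fin (suc n)
succ-sat {zero}  F.zero    = F.zero
succ-sat {suc n} F.zero    = F.suc F.zero
succ-sat {suc n} (F.suc i) = F.suc (succ-sat i)

toℕ-succ-sat : ∀ {n} (i : Fin (suc n)) → toℕ (succ-sat i) ≡ suc (toℕ i) ⊓ n
toℕ-succ-sat {zero}  F.zero    = refl
toℕ-succ-sat {suc n} F.zero    = refl
toℕ-succ-sat {suc n} (F.suc i) = cong suc (toℕ-succ-sat i)

step : ∀ {n} → Fin (suc n) → Fin (suc n)
step F.zero    = F.zero
step (F.suc i) = succ-sat (F.suc i)

step-mono : ∀ {n} {i j : Fin (suc n)} → i F.≤ j → step i F.≤ step j
step-mono {n} {F.zero}  _ = z≤n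
step-mono {n} {F.suc i} {F.suc j} i≤j =
  subst₂ ℕ._≤_ (sym (toℕ-succ-sat (F.suc i))) (sym (toℕ-succ-sat (F.suc j)))
         (ℕP.⊓-monoˡ-≤ n (s≤s i≤j))

step-≤-suc : ∀ {n} (i : Fin (suc n)) → toℕ (step i) ℕ.≤ suc (toℕ i)
step-≤-suc F.zero    = z≤n
step-≤-suc {n} (F.suc i) =
  subst (ℕ._≤ suc (toℕ (F.suc i))) (sym (toℕ-succ-sat (F.suc i)))
        (ℕP.m⊓n≤m (suc (toℕ (F.suc i))) n)

step-pos : ∀ {n} (i : Fin (suc n)) → 0 ℕ.< toℕ i → 0 ℕ.< toℕ (step i)
step-pos {suc n} (F.suc i) _ = s≤s z≤n

toℕ-step-pos : ∀ {n} (i : Fin (suc n)) → 0 ℕ.< toℕ i → toℕ (step i) ≡ suc (toℕ i) ⊓ n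
toℕ-step-pos (F.suc i) _ = toℕ-succ-sat (F.suc i)

suc-⊓-absorb : ∀ m n → suc (m ⊓ n) ⊓ n ≡ suc m ⊓ n
suc-⊓-absorb m n = begin
  (suc m ⊓ suc n) ⊓ n  ≡⟨ ℕP.⊓-assoc (suc m) (suc n) n ⟩
  suc m ⊓ (suc n ⊓ n)  ≡⟨ cong (suc m ⊓_) (ℕP.m≥n⇒m⊓n≡n (ℕP.n≤1+n n)) ⟩
  suc m ⊓ n            ∎
  where open ≡-Reasoning

module Chain (n : ℕ) where

  top : Fin (suc n)
  top = fromℕ n

  isTop : Fin (suc n) → Bool
  isTop w = does (w F.≟ top)

  isTop-sound : ∀ w → isTop w ≡ true → w ≡ top
  isTop-sound w with w F.≟ top
  ... | yes w≡top = λ _ → w≡top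
  ... | no _      = λ ()

  -- Nothing lies strictly above the top, so the valuation is monotone.
  isTop-mono : ∀ {w v} → w F.≤ v → isTop w ≡ true → isTop v ≡ true
  isTop-mono {w} {v} w≤v h = dec-true (v F.≟ top) v≡top
    where
    top≤v : top F.≤ v
    top≤v = subst (F._≤ v) (isTop-sound w h) w≤v
    v≡top : v ≡ top
    v≡top = FP.≤-antisym (FP.≤fromℕ v) top≤v

  chain : FinModel
  chain = record
    { n      = n
    ; _≼_    = F._≤_
    ; isPO   = FP.≤-isPartialOrder
    ; S      = step
    ; S-mono = step-mono
    ; V      = λ w _ → isTop w
    ; V-mono = λ _ → isTop-mono
    }

  _⊩_ : Fin (suc n) → Form → Set
  _⊩_ = _⊨_ chain

  iter-bottom : ∀ k → iter chain k F.zero ≡ F.zero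
  iter-bottom zero    = refl
  iter-bottom (suc k) = cong step (iter-bottom k)

  iter-pos : ∀ k (w : Fin (suc n)) → 0 ℕ.< toℕ w → 0 ℕ.< toℕ (iter chain k w)
  iter-pos zero    w w>0 = w>0
  iter-pos (suc k) w w>0 = step-pos (iter chain k w) (iter-pos k w w>0)

  toℕ-iter-pos : ∀ k (w : Fin (suc n)) → 0 ℕ.< toℕ w →
                 toℕ (iter chain k w) ≡ (toℕ w + k) ⊓ n
  toℕ-iter-pos zero w _ = begin
    toℕ w            ≡⟨ sym (ℕP.m≤n⇒m⊓n≡m (FP.toℕ≤pred[n] w)) ⟩
    toℕ w ⊓ n        ≡⟨ cong (_⊓ n) (sym (ℕP.+-identityʳ (toℕ w))) ⟩
    (toℕ w + 0) ⊓ n  ∎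
    where open ≡-Reasoning
  toℕ-iter-pos (suc k) w w>0 = begin
    toℕ (step (iter chain k w))    ≡⟨ toℕ-step-pos (iter chain k w) (iter-pos k w w>0) ⟩
    suc (toℕ (iter chain k w)) ⊓ n ≡⟨ cong (λ x → suc x ⊓ n) (toℕ-iter-pos k w w>0) ⟩
    suc ((toℕ w + k) ⊓ n) ⊓ n      ≡⟨ suc-⊓-absorb (toℕ w + k) n ⟩
    suc (toℕ w + k) ⊓ n            ≡⟨ cong (_⊓ n) (sym (ℕP.+-suc (toℕ w) k)) ⟩
    (toℕ w + suc k) ⊓ n            ∎
    where open ≡-Reasoning

  below-top-refutes : ∀ q (i : Fin (suc n)) → toℕ i ℕ.< n → ¬ (i ⊩ var q)
  below-top-refutes _ i i<n h =
    ℕP.<⇒≢ i<n (trans (cong toℕ (isTop-sound i h)) (FP.toℕ-fromℕ n))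

  positive-reaches-top : ∀ q (w : Fin (suc n)) → 0 ℕ.< toℕ w → w ⊩ ◇ (var q)
  positive-reaches-top _ w w>0 = n , dec-true (iter chain n w F.≟ top) reached
    where
    reached : iter chain n w ≡ top
    reached = FP.toℕ-injective (begin
      toℕ (iter chain n w)  ≡⟨ toℕ-iter-pos n w w>0 ⟩
      (toℕ w + n) ⊓ n       ≡⟨ ℕP.m≥n⇒m⊓n≡n (ℕP.m≤n+m n (toℕ w)) ⟩
      n                     ≡⟨ sym (FP.toℕ-fromℕ n) ⟩
      toℕ top               ∎)
      where open ≡-Reasoning

  bottom-refutes-◇ : ∀ q → 0 ℕ.< n → ¬ (F.zero ⊩ ◇ (var q))
  bottom-refutes-◇ q 0<n (k , h) =
    below-top-refutes q F.zero 0<n (subst (_⊩ var q) (iter-bottom k) h)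

  -- Worlds seen
  -- from i within r steps are below the top, hence indistinguishable from the
  -- bottom by variables; the orbit of the bottom is constant, so □ there
  -- reduces to truth at the bottom; and → is handled by totality of the
  -- order together with persistence.
  descend : ∀ φ → InLBox φ → ∀ r → ○-depth φ ℕ.≤ r →
            ∀ i → toℕ i + r ℕ.< n → i ⊩ φ → F.zero ⊩ φ
  descend (var q) _ r _ i room h =
    ⊥-elim (below-top-refutes q i (ℕP.≤-<-trans (ℕP.m≤m+n (toℕ i) r) room) h)
  descend ⊥' _ _ _ _ _ ()
  descend (φ ∧' ψ) (bφ , bψ) r d≤r i room (a , b) =
    descend φ bφ r (ℕP.m⊔n≤o⇒m≤o _ _ d≤r) i room a ,
    descend ψ bψ r (ℕP.m⊔n≤o⇒n≤o _ _ d≤r) i room b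
  descend (φ ∨' ψ) (bφ , bψ) r d≤r i room (inj₁ a) =
    inj₁ (descend φ bφ r (ℕP.m⊔n≤o⇒m≤o _ _ d≤r) i room a)
  descend (φ ∨' ψ) (bφ , bψ) r d≤r i room (inj₂ b) =
    inj₂ (descend ψ bψ r (ℕP.m⊔n≤o⇒n≤o _ _ d≤r) i room b)
  descend (φ ⇒ ψ) (bφ , bψ) r d≤r i room h v _ v⊩φ with FP.≤-total i v
  ... | inj₁ i≤v = h v i≤v v⊩φ
  ... | inj₂ v≤i = persist chain ψ z≤n (descend ψ bψ r (ℕP.m⊔n≤o⇒n≤o _ _ d≤r) i room i⊩ψ)
    where
    -- v is below i, so it has at least as much room; bring φ down to the
    -- bottom, push it back up to i, and use the implication there.
    0⊩φ : F.zero ⊩ φ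
    0⊩φ = descend φ bφ r (ℕP.m⊔n≤o⇒m≤o _ _ d≤r) v
            (ℕP.≤-<-trans (ℕP.+-monoˡ-≤ r v≤i) room) v⊩φ
    i⊩ψ : i ⊩ ψ
    i⊩ψ = h i FP.≤-refl (persist chain φ z≤n 0⊩φ)
  descend (○ φ) bφ (suc r) (s≤s d≤r) i room h = descend φ bφ r d≤r (step i) room′ h
    where
    -- one step uses up one unit of room
    room′ : toℕ (step i) + r ℕ.< n
    room′ = ℕP.≤-<-trans (ℕP.+-monoˡ-≤ r (step-≤-suc i))
                         (subst (ℕ._< n) (ℕP.+-suc (toℕ i) r) room)
  descend (□ φ) bφ r d≤r i room h k =
    subst (_⊩ φ) (sym (iter-bottom k)) (descend φ bφ r d≤r i room (h 0))

mainTheorem3 : (p : ℕ) → ¬ (Σ Form λ φ → InLBox φ × ValidFin (◇ (var p) ⇔ φ))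
mainTheorem3 p (φ , φ∈L□ , valid) = bottom-refutes-◇ p (s≤s z≤n) ◇p-at-bottom
  where
  -- Work in the chain of height ○-depth φ + 2, so world 1 has enough room.
  height : ℕ
  height = suc (suc (○-depth φ))
  open Chain height
  one : Fin (suc height)
  one = F.suc F.zero
  ◇p-at-one : one ⊩ ◇ (var p)
  ◇p-at-one = positive-reaches-top p one (s≤s z≤n)
  φ-at-bottom : F.zero ⊩ φ
  φ-at-bottom = descend φ φ∈L□ (○-depth φ) ℕP.≤-refl one ℕP.≤-refl
                        (valid-⇔⇒ chain (◇ (var p)) φ (valid chain) one ◇p-at-one)
  ◇p-at-bottom : F.zero ⊩ ◇ (var p)
  ◇p-at-bottom = valid-⇔⇐ chain (◇ (var p)) φ (valid chain) F.zero φ-at-bottom
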